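{- Let $p$ and $q$ be two-dimensional partitions and let $p\vdash (n,m)$. Suppose that $p$ and $q$ are related by one of the following four relations: 1. $q=p\backslash(1,1)$; 2. $q=A_{i,j}(p)$ for some $i,j$; 3. $q=p\backslash(1,0),(0,2)$; 4. $q=B_{i,j}(p\backslash (1,0))$ for some $i,j$. Then: (1) $|p|=|q|+1$ in case 1, $|p|=|q|$ in case 2, $|p|=|q|+2$ in case 3, $|p|=|q|+1$ in case 4; and $q\vdash(n-1,m-1)$ in case 1, $q\vdash(n-1,m)$ in case 2, $q\vdash(n-1,m-2)$ in case 3, $q\vdash(n-1,m-1)$ in case 4. (2) $p\vdash (n,|p|-1)$ if and only if $q\vdash (n-1,|q|-1)$. (3) If $(0,1)\notin q$ then $(0,1)\notin p$; and if $(0,1)\notin p$ then $(0,1)\notin q$ unless either $p$ and $q$ are related by case 2 with $(i,j)=(1,1)$, or by case 4 with $(i,j)=(0,2)$. In either of these exceptions, $(0,1)\in q$. (4) $\alpha_q=\frac{e_{p,1,1}}{nm}\alpha_p$ in case 1; $\alpha_q=\frac{ie_{p,i,j}}{n(e_{p,i-1,j}+1)}\alpha_p$ in case 2; $\alpha_q=\frac{2e_{p,1,0}e_{p,0,2}}{nm(m-1)}\alpha_p$ in case 3; $\alpha_q=\frac{je_{p,i,j}e_{p,1,0}}{nm(e_{p\backslash(1,0),i,j-1}+1)}\alpha_p$ in case 4.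
   Context: A two-dimensional partition $p\vdash(n,m)$ is a lexicographically ordered sequence of pairs $(p_{i1},p_{i2})$ of non-negative integers, each pair not both zero, with $\sum_i p_{i1}=n$, $\sum_i p_{i2}=m$; $|p|$ is the number of parts, and $e_{p,k,l}$ is the number of parts equal to $(k,l)$. For $p\vdash(n,m)$, $\alpha_p=\frac{n!\,m!}{\prod_i p_{i1}!p_{i2}!\prod_{k,l}e_{p,k,l}!}$. The notation $p\backslash(a,b)$ (resp. $p\backslash(a,b),(c,d)$) means $p$ with one copy of the specified part(s) removed, assuming $p$ contains them. For $i>0$, $j\geq 0$, $(i,j)\neq(1,0)$ and $e_{p,i,j}>0$, $A_{i,j}(p)$ is the partition obtained from $p$ by replacing one part $(i,j)$ by $(i-1,j)$ (i.e. $e_{q,i,j}=e_{p,i,j}-1$, $e_{q,i-1,j}=e_{p,i-1,j}+1$, other multiplicities unchanged). For $i\geq 0$, $j>0$, $(i,j)\neq(0,1)$ and $e_{p,i,j}>0$, $B_{i,j}(p)$ is the partition obtained from $p$ by replacing one part $(i,j)$ by $(i,j-1)$. In relations 2 and 4 it is assumed that $A_{i,j}$ resp. $B_{i,j}$ is defined. -}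

module Defs where

open import Data.Nat using (ℕ; zero; suc; _+_; _*_; _∸_; _<_; _≤_; _≡ᵇ_; _!; NonZero)
open import Data.Nat.Properties using (_!≢0; m*n≢0)
open import Data.Bool using (if_then_else_; _∧_)
open import Data.Product using (_×_; _,_; proj₁; proj₂)
open import Data.List using (List; []; _∷_; map; length; upTo; concatMap; _++_)
open import Data.Nat.ListAction using (sum)
open import Data.Sum using (_⊎_)
open import Data.List.Relation.Unary.All using (All)
open import Data.List.Relation.Unary.Linked using (Linked)
open import Data.Integer using (ℤ; +_)
open import Data.Rational using (ℚ; _/_)
open import Relation.Binary.PropositionalEquality using (_≡_; _≢_)

Part : Set
Part = ℕ × ℕ

_≥ₗ_ : Part → Part → Set
(a , b) ≥ₗ (c , d) = (c < a) ⊎ (a ≡ c × d ≤ b)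

record TwoDimPartition : Set where
  constructor mkPartition
  field
    parts   : List Part
    nonzero : All (λ x → x ≢ (0 , 0)) parts
    ordered : Linked _≥ₗ_ parts

open TwoDimPartition public

sum₁ sum₂ : TwoDimPartition → ℕ
sum₁ p = sum (map proj₁ (parts p))
sum₂ p = sum (map proj₂ (parts p))

_⊢_ : TwoDimPartition → ℕ × ℕ → Set
p ⊢ (n , m) = sum₁ p ≡ n × sum₂ p ≡ m

-- the same relation with integer arguments, so that expressions such as
-- (n - 1 , |p| - 1) are read without truncated subtraction
_⊢ᶻ_ : TwoDimPartition → ℤ × ℤ → Set
p ⊢ᶻ (a , b) = + sum₁ p ≡ a × + sum₂ p ≡ b

size : TwoDimPartition → ℕ
size p = length (parts p)

δ : Part → Part → ℕ
δ (a , b) (c , d) = if (a ≡ᵇ c) ∧ (b ≡ᵇ d) then 1 else 0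

count : ℕ → ℕ → List Part → ℕ
count k l []       = 0
count k l (x ∷ xs) = δ x (k , l) + count k l xs

e : TwoDimPartition → ℕ → ℕ → ℕ
e p k l = count k l (parts p)

-- q = p \ x  (one copy of x removed; requires x ∈ p, which is implied)
Removes : TwoDimPartition → Part → TwoDimPartition → Set
Removes p x q = ∀ k l → e q k l + δ (k , l) x ≡ e p k l

Removes₂ : TwoDimPartition → Part → Part → TwoDimPartition → Set
Removes₂ p x y q = ∀ k l → e q k l + δ (k , l) x + δ (k , l) y ≡ e p k l

-- q = A_{i,j}(p), including the conditions that A_{i,j} is defined
IsA : ℕ → ℕ → TwoDimPartition → TwoDimPartition → Set
IsA i j p q =
  0 < i × (i , j) ≢ (1 , 0) × 0 < e p i j ×
  (∀ k l → e q k l + δ (k , l) (i , j) ≡ e p k l + δ (k , l) (i ∸ 1 , j))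

-- q = B_{i,j}(p), including the conditions that B_{i,j} is defined
IsB : ℕ → ℕ → TwoDimPartition → TwoDimPartition → Set
IsB i j p q =
  0 < j × (i , j) ≢ (0 , 1) × 0 < e p i j ×
  (∀ k l → e q k l + δ (k , l) (i , j) ≡ e p k l + δ (k , l) (i , j ∸ 1))

prod! : List ℕ → ℕ
prod! []       = 1
prod! (x ∷ xs) = x ! * prod! xs

prod!≢0 : ∀ xs → NonZero (prod! xs)
prod!≢0 []       = _
prod!≢0 (x ∷ xs) = m*n≢0 (x !) (prod! xs) {{x !≢0}} {{prod!≢0 xs}}


-- the list of numbers whose factorials form the denominator of α_p:
-- all p_{i1}, p_{i2}, and all multiplicities e_{p,k,l} for k ≤ n, l ≤ m
-- (multiplicities outside this range are 0, contributing 0! = 1).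
αFactors : TwoDimPartition → List ℕ
αFactors p =
  concatMap (λ x → proj₁ x ∷ proj₂ x ∷ []) (parts p) ++
  concatMap (λ k → map (λ l → e p k l) (upTo (suc (sum₂ p)))) (upTo (suc (sum₁ p)))

-- α_p = n! m! / (∏ p_{i1}! p_{i2}! ∏ e_{p,k,l}!)   for p ⊢ (n,m), as a rational
α : TwoDimPartition → ℚ
α p = (+ (sum₁ p ! * sum₂ p !) / prod! (αFactors p)) {{prod!≢0 (αFactors p)}}

ℕ→ℚ : ℕ → ℚ
ℕ→ℚ n = + n / 1

module Submission where

-- Each of the four relations says that the multiset of parts of q
-- is obtained from that of p by removing or exchanging one or two explicit parts.
-- We first show that equal multiplicities force the lists of parts to be
-- permutations of each other (mult-ext), so every relation becomes a permutation
-- such as  parts p ↭ (1 , 1) ∷ parts q  or  (i , j) ∷ parts q ↭ (i - 1 , j) ∷ parts p.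
-- All quantities in the theorem are functions of the multiset:
--   * |p|, n = sum₁ p and m = sum₂ p are permutation-invariant sums, which gives
--     a Step record (n drops by 1, |p| and m drop by the same d) and from it
--     parts (1) and (2);
--   * membership of (0,1) only changes when (0,1) itself is added or removed (3);
--   * α_p = n! m! / den (parts p), where den is the product of the factorials of
--     all coordinates and of all multiplicities; den is permutation-invariant and
--     adding a part (a , b) multiplies it by a! b! (e_{a,b} + 1) (den-∷).  Comparing
--     numerators and denominators (α-ratio) gives the formulas (4).

open import Defs
open import Data.Nat using (ℕ; zero; suc; pred; _+_; _*_; _∸_; _≤_; _<_; _!; z≤n; s≤s; _≟_; NonZero)
open import Data.Nat.Properties
  using (+-comm; +-suc; +-identityʳ; *-identityˡ; *-identityʳ; *-assoc; +-cancelˡ-≡; *-cancelˡ-≡;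
         suc-injective; m*n≢0; _!≢0; ≤-trans; ≤-reflexive; m≤m+n; m≤n+m; n≤0⇒n≡0; ≮⇒≥; <⇒≱)
open import Data.Nat.ListAction using (sum; product)
open import Data.Nat.ListAction.Properties using (sum-↭; product-↭)
open import Data.Nat.Tactic.RingSolver using (solve-∀)
open import Data.Bool using (if_then_else_; _∧_)
open import Data.Product using (_×_; _,_; proj₁; proj₂; ∃)
open import Data.Product.Properties using (≡-dec)
open import Data.List using (List; []; _∷_; map; applyUpTo; concatMap; _++_)
open import Data.List.Membership.Propositional using (_∈_; _∉_)
open import Data.List.Membership.Propositional.Properties using (∈-∃++)
open import Data.List.Relation.Unary.Any using (here; there)
open import Data.List.Relation.Binary.Permutation.Propositional using (_↭_; prep; ↭-refl; ↭-sym; ↭-trans)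
open import Data.List.Relation.Binary.Permutation.Propositional.Properties using (map⁺; ↭-length; shift; ∈-resp-↭)
open import Data.Integer using (+_; _-_; _⊖_) renaming (_*_ to _*ℤ_)
import Data.Integer.Properties as ℤ
open import Data.Rational using (toℚᵘ; 1ℚ) renaming (_/_ to _/ℚ_; _*_ to _*ℚ_; _-_ to _-ℚ_; -_ to -ℚ_)
open import Data.Rational.Properties using (toℚᵘ-injective; toℚᵘ-fromℚᵘ; toℚᵘ-homo-*; toℚᵘ-homo-+)
open import Data.Rational.Unnormalised using (mkℚᵘ; *≡*) renaming (_≃_ to _≃ᵘ_)
open import Data.Rational.Unnormalised.Properties using (≃-refl; ≃-trans; ≃-sym; ≃-reflexive; +-cong; *-cong)
open import Function.Bundles using (_⇔_; mk⇔; Equivalence)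
open import Relation.Nullary using (Dec; does; yes; no; contradiction)
open import Relation.Nullary.Decidable using (dec-true; dec-false)
open import Relation.Binary.PropositionalEquality
  using (_≡_; _≢_; refl; sym; trans; cong; cong₂; subst; module ≡-Reasoning)

δ-unfold : ∀ a b c d → δ (a , b) (c , d) ≡ (if does (a ≟ c) ∧ does (b ≟ d) then 1 else 0)
δ-unfold a b c d = refl

δ-same : ∀ x → δ x x ≡ 1
δ-same (a , b) rewrite δ-unfold a b a b | dec-true (a ≟ a) refl | dec-true (b ≟ b) refl = refl

δ-diff : ∀ x y → x ≢ y → δ x y ≡ 0
δ-diff (a , b) (c , d) x≢y with a ≟ c
... | no a≢c rewrite δ-unfold a b c d | dec-false (a ≟ c) a≢c = refl
... | yes refl rewrite δ-unfold a b a d | dec-true (a ≟ a) refl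
                     | dec-false (b ≟ d) (λ { refl → x≢y refl }) = refl

_≟ₚ_ : (x y : Part) → Dec (x ≡ y)
_≟ₚ_ = ≡-dec _≟_ _≟_

δ-sym : ∀ x y → δ x y ≡ δ y x
δ-sym x y with x ≟ₚ y
... | yes refl = refl
... | no x≢y   = trans (δ-diff x y x≢y) (sym (δ-diff y x (λ e → x≢y (sym e))))

mult : Part → List Part → ℕ
mult (k , l) = count k l

Σ[_] : (Part → ℕ) → List Part → ℕ
Σ[ f ] L = sum (map f L)

mult-as-sum : ∀ x L → mult x L ≡ Σ[ (λ y → δ y x) ] L
mult-as-sum x []      = refl
mult-as-sum x (y ∷ L) = cong (λ s → δ y x + s) (mult-as-sum x L)

Σ-↭ : ∀ f {L M} → L ↭ M → Σ[ f ] L ≡ Σ[ f ] M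
Σ-↭ f σ = sum-↭ (map⁺ f σ)

mult-↭ : ∀ x {L M} → L ↭ M → mult x L ≡ mult x M
mult-↭ x {L} {M} σ = begin
  mult x L               ≡⟨ mult-as-sum x L ⟩
  Σ[ (λ y → δ y x) ] L   ≡⟨ Σ-↭ (λ y → δ y x) σ ⟩
  Σ[ (λ y → δ y x) ] M   ≡⟨ mult-as-sum x M ⟨
  mult x M               ∎
  where open ≡-Reasoning

mult-pos⇒∈ : ∀ x L → 0 < mult x L → x ∈ L
mult-pos⇒∈ x (y ∷ L) pos with y ≟ₚ x
... | yes refl = here refl
... | no y≢x   = there (mult-pos⇒∈ x L (subst (0 <_) (cong (_+ mult x L) (δ-diff y x y≢x)) pos))

mult-∉ : ∀ {x L} → x ∉ L → mult x L ≡ 0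
mult-∉ {x} {L} x∉L = n≤0⇒n≡0 (≮⇒≥ (λ pos → x∉L (mult-pos⇒∈ x L pos)))

∈⇒↭∷ : ∀ {x : Part} {L} → x ∈ L → ∃ λ L′ → L ↭ x ∷ L′
∈⇒↭∷ x∈L with ys , zs , refl ← ∈-∃++ x∈L = ys ++ zs , shift _ ys zs

mult-ext : ∀ L M → (∀ x → mult x L ≡ mult x M) → L ↭ M
mult-ext []      []      _    = _↭_.refl
mult-ext []      (y ∷ M) same with () ← trans (same y) (cong (_+ mult y M) (δ-same y))
mult-ext (y ∷ L) M       same = ↭-trans (prep y (mult-ext L M′ same′)) (↭-sym M↭yM′)
  where
  y∈M : y ∈ M
  y∈M = mult-pos⇒∈ y M (subst (0 <_) (trans (sym (cong (_+ mult y L) (δ-same y))) (same y)) (s≤s z≤n))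
  M′ : List Part
  M′ = proj₁ (∈⇒↭∷ y∈M)
  M↭yM′ : M ↭ y ∷ M′
  M↭yM′ = proj₂ (∈⇒↭∷ y∈M)
  same′ : ∀ x → mult x L ≡ mult x M′
  same′ x = +-cancelˡ-≡ (δ y x) _ _ (trans (same x) (mult-↭ x M↭yM′))

-- The relations of the theorem, rephrased as permutations of the lists of parts.

mult-∷ʳ : ∀ z x L → mult z L + δ z x ≡ mult z (x ∷ L)
mult-∷ʳ z x L = trans (+-comm (mult z L) (δ z x)) (cong (_+ mult z L) (δ-sym z x))

removes⇒↭ : ∀ p x q → Removes p x q → parts p ↭ x ∷ parts q
removes⇒↭ p x q R = mult-ext (parts p) (x ∷ parts q) λ z →
  trans (sym (R (proj₁ z) (proj₂ z))) (mult-∷ʳ z x (parts q))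

removes₂⇒↭ : ∀ p x y q → Removes₂ p x y q → parts p ↭ x ∷ y ∷ parts q
removes₂⇒↭ p x y q R = mult-ext (parts p) (x ∷ y ∷ parts q) λ z → begin
  mult z (parts p)                         ≡⟨ R (proj₁ z) (proj₂ z) ⟨
  mult z (parts q) + δ z x + δ z y         ≡⟨ swap-last (mult z (parts q)) (δ z x) (δ z y) ⟩
  mult z (parts q) + δ z y + δ z x         ≡⟨ cong (_+ δ z x) (mult-∷ʳ z y (parts q)) ⟩
  mult z (y ∷ parts q) + δ z x             ≡⟨ mult-∷ʳ z x (y ∷ parts q) ⟩
  mult z (x ∷ y ∷ parts q)                 ∎
  where
  open ≡-Reasoning
  swap-last : ∀ a b c → a + b + c ≡ a + c + b
  swap-last = solve-∀

exchange⇒↭ : ∀ p x y q → (∀ k l → e q k l + δ (k , l) x ≡ e p k l + δ (k , l) y) →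
             x ∷ parts q ↭ y ∷ parts p
exchange⇒↭ p x y q R = mult-ext (x ∷ parts q) (y ∷ parts p) λ z →
  trans (sym (mult-∷ʳ z x (parts q))) (trans (R (proj₁ z) (proj₂ z)) (mult-∷ʳ z y (parts p)))

∈-tail : ∀ {z y : Part} {M} → z ∈ y ∷ M → z ≢ y → z ∈ M
∈-tail (here z≡y) z≢y = contradiction z≡y z≢y
∈-tail (there z∈M) _  = z∈M

∈-transfer : ∀ {z y : Part} {L M} → L ↭ y ∷ M → z ≢ y → z ∈ L → z ∈ M
∈-transfer σ z≢y z∈L = ∈-tail (∈-resp-↭ σ z∈L) z≢y

removal-∉ : ∀ {z y : Part} {L M} → L ↭ y ∷ M → z ≢ y → (z ∉ M → z ∉ L) × (z ∉ L → z ∉ M)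
removal-∉ σ z≢y = (λ z∉M z∈L → z∉M (∈-transfer σ z≢y z∈L))
                , (λ z∉L z∈M → z∉L (∈-resp-↭ (↭-sym σ) (there z∈M)))

exchange-∉ : ∀ {z x y : Part} {L M} → x ∷ L ↭ y ∷ M → z ≢ x →
             (z ∉ L → z ∉ M) × (z ≢ y → z ∉ M → z ∉ L) × (z ≡ y → z ∈ L)
exchange-∉ σ z≢x = (λ z∉L z∈M → z∉L (∈-transfer (↭-sym σ) z≢x (there z∈M)))
                 , (λ z≢y z∉M z∈L → z∉M (∈-transfer σ z≢y (there z∈L)))
                 , (λ { refl → ∈-transfer (↭-sym σ) z≢x (here refl) })

∏< : ℕ → (ℕ → ℕ) → ℕ
∏< zero    f = 1
∏< (suc n) f = f 0 * ∏< n (λ k → f (suc k))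

∏<-cong : ∀ n {f g} → (∀ k → k < n → f k ≡ g k) → ∏< n f ≡ ∏< n g
∏<-cong zero    _     = refl
∏<-cong (suc n) f≗g = cong₂ _*_ (f≗g 0 (s≤s z≤n)) (∏<-cong n (λ k k<n → f≗g (suc k) (s≤s k<n)))

∏<-ones : ∀ n {f} → (∀ k → f k ≡ 1) → ∏< n f ≡ 1
∏<-ones zero    _    = refl
∏<-ones (suc n) ones = cong₂ _*_ (ones 0) (∏<-ones n (λ k → ones (suc k)))

∏<-tail : ∀ {N N′ f} → N ≤ N′ → (∀ k → N ≤ k → f k ≡ 1) → ∏< N′ f ≡ ∏< N f
∏<-tail {N′ = N′} z≤n ones = ∏<-ones N′ (λ k → ones k z≤n)
∏<-tail {f = f} (s≤s N≤N′) ones = cong (f 0 *_) (∏<-tail N≤N′ (λ k N≤k → ones (suc k) (s≤s N≤k)))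

∏<-update : ∀ N a {f g c} → a < N → (∀ k → k ≢ a → f k ≡ g k) → f a ≡ c * g a →
            ∏< N f ≡ c * ∏< N g
∏<-update (suc N) zero {f} {g} {c} _ agree fa = begin
  f 0 * ∏< N (λ k → f (suc k))       ≡⟨ cong₂ _*_ fa (∏<-cong N (λ k _ → agree (suc k) (λ ()))) ⟩
  c * g 0 * ∏< N (λ k → g (suc k))   ≡⟨ *-assoc c (g 0) _ ⟩
  c * (g 0 * ∏< N (λ k → g (suc k))) ∎
  where open ≡-Reasoning
∏<-update (suc N) (suc a) {f} {g} {c} (s≤s a<N) agree fa = begin
  f 0 * ∏< N (λ k → f (suc k))       ≡⟨ cong₂ _*_ (agree 0 (λ ())) (∏<-update N a {c = c} a<N agree′ fa) ⟩
  g 0 * (c * ∏< N (λ k → g (suc k))) ≡⟨ left-comm (g 0) c _ ⟩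
  c * (g 0 * ∏< N (λ k → g (suc k))) ∎
  where
  open ≡-Reasoning
  agree′ : ∀ k → k ≢ a → f (suc k) ≡ g (suc k)
  agree′ k k≢a = agree (suc k) (λ e → k≢a (suc-injective e))
  left-comm : ∀ x y z → x * (y * z) ≡ y * (x * z)
  left-comm = solve-∀

-- The denominator of α_p: the factorials of all coordinates of parts, times
-- the factorials of all multiplicities e_{p,k,l} (over a grid containing every part).

partFactorials : List Part → ℕ
partFactorials L = prod! (concatMap (λ x → proj₁ x ∷ proj₂ x ∷ []) L)

partFactorials-as-product : ∀ L → partFactorials L ≡ product (map (λ x → proj₁ x ! * proj₂ x !) L)
partFactorials-as-product []            = refl
partFactorials-as-product ((a , b) ∷ L) =
  trans (sym (*-assoc (a !) (b !) _)) (cong (a ! * b ! *_) (partFactorials-as-product L))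

partFactorials-↭ : ∀ {L M} → L ↭ M → partFactorials L ≡ partFactorials M
partFactorials-↭ {L} {M} σ = begin
  partFactorials L                                  ≡⟨ partFactorials-as-product L ⟩
  product (map (λ x → proj₁ x ! * proj₂ x !) L)     ≡⟨ product-↭ (map⁺ _ σ) ⟩
  product (map (λ x → proj₁ x ! * proj₂ x !) M)     ≡⟨ partFactorials-as-product M ⟨
  partFactorials M                                  ∎
  where open ≡-Reasoning

grid : List Part → ℕ → ℕ → ℕ
grid L N K = ∏< N (λ k → ∏< K (λ l → count k l L !))

-- the grid used by αFactors: it contains every part
multFactorials : List Part → ℕ
multFactorials L = grid L (suc (Σ[ proj₁ ] L)) (suc (Σ[ proj₂ ] L))

∈⇒≤Σ : ∀ f {x L} → x ∈ L → f x ≤ Σ[ f ] L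
∈⇒≤Σ f {L = y ∷ L} (here refl) = m≤m+n (f y) (Σ[ f ] L)
∈⇒≤Σ f {L = y ∷ L} (there x∈L) = ≤-trans (∈⇒≤Σ f x∈L) (m≤n+m (Σ[ f ] L) (f y))

mult-beyond : ∀ f x L → Σ[ f ] L < f x → mult x L ≡ 0
mult-beyond f x L Σ<fx = mult-∉ {x} {L} (λ x∈L → <⇒≱ Σ<fx (∈⇒≤Σ f x∈L))

grid-canonical : ∀ L {N K} → suc (Σ[ proj₁ ] L) ≤ N → suc (Σ[ proj₂ ] L) ≤ K → grid L N K ≡ multFactorials L
grid-canonical L {N} {K} hN hK = begin
  grid L N K                                                  ≡⟨ ∏<-cong N (λ k _ → ∏<-tail hK (emptyColumn k)) ⟩
  ∏< N (λ k → ∏< (suc (Σ[ proj₂ ] L)) (λ l → count k l L !))  ≡⟨ ∏<-tail hN emptyRow ⟩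
  multFactorials L                                            ∎
  where
  open ≡-Reasoning
  emptyColumn : ∀ k l → suc (Σ[ proj₂ ] L) ≤ l → count k l L ! ≡ 1
  emptyColumn k l l> = cong _! (mult-beyond proj₂ (k , l) L l>)
  emptyRow : ∀ k → suc (Σ[ proj₁ ] L) ≤ k → ∏< (suc (Σ[ proj₂ ] L)) (λ l → count k l L !) ≡ 1
  emptyRow k k> = ∏<-ones (suc (Σ[ proj₂ ] L)) (λ l → cong _! (mult-beyond proj₁ (k , l) L k>))

-- adding a part (a , b) changes exactly one grid entry, from c ! to (c + 1) !
grid-∷ : ∀ a b L {N K} → a < N → b < K → grid ((a , b) ∷ L) N K ≡ suc (mult (a , b) L) * grid L N K
grid-∷ a b L {N} {K} a<N b<K = ∏<-update N a {c = suc (mult (a , b) L)} a<N otherRow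
  (∏<-update K b {c = suc (mult (a , b) L)} b<K otherColumn (cong (λ t → (t + count a b L) !) (δ-same (a , b))))
  where
  otherColumn : ∀ l → l ≢ b → count a l ((a , b) ∷ L) ! ≡ count a l L !
  otherColumn l l≢b = cong (λ t → (t + count a l L) !) (δ-diff (a , b) (a , l) (λ e → l≢b (sym (cong proj₂ e))))
  otherRow : ∀ k → k ≢ a → ∏< K (λ l → count k l ((a , b) ∷ L) !) ≡ ∏< K (λ l → count k l L !)
  otherRow k k≢a =
    ∏<-cong K (λ l _ → cong (λ t → (t + count k l L) !) (δ-diff (a , b) (k , l) (λ e → k≢a (sym (cong proj₁ e)))))

multFactorials-∷ : ∀ a b L → multFactorials ((a , b) ∷ L) ≡ suc (mult (a , b) L) * multFactorials L
multFactorials-∷ a b L =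
  trans (grid-∷ a b L (s≤s (m≤m+n a _)) (s≤s (m≤m+n b _)))
        (cong (suc (mult (a , b) L) *_) (grid-canonical L (s≤s (m≤n+m _ a)) (s≤s (m≤n+m _ b))))

grid-cong : ∀ {L M} N K → (∀ x → mult x L ≡ mult x M) → grid L N K ≡ grid M N K
grid-cong N K same = ∏<-cong N (λ k _ → ∏<-cong K (λ l _ → cong _! (same (k , l))))

multFactorials-↭ : ∀ {L M} → L ↭ M → multFactorials L ≡ multFactorials M
multFactorials-↭ {L} {M} σ =
  trans (sym (grid-canonical L (≤-reflexive (cong suc (Σ-↭ proj₁ σ))) (≤-reflexive (cong suc (Σ-↭ proj₂ σ)))))
        (grid-cong {L} {M} (suc (Σ[ proj₁ ] M)) (suc (Σ[ proj₂ ] M)) (λ x → mult-↭ x σ))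

den : List Part → ℕ
den L = partFactorials L * multFactorials L

den-↭ : ∀ {L M} → L ↭ M → den L ≡ den M
den-↭ σ = cong₂ _*_ (partFactorials-↭ σ) (multFactorials-↭ σ)

den-∷ : ∀ a b L → den ((a , b) ∷ L) ≡ a ! * b ! * suc (mult (a , b) L) * den L
den-∷ a b L = trans (cong (a ! * (b ! * partFactorials L) *_) (multFactorials-∷ a b L))
                    (regroup (a !) (b !) (partFactorials L) (suc (mult (a , b) L)) (multFactorials L))
  where
  regroup : ∀ x y P c G → x * (y * P) * (c * G) ≡ x * y * c * (P * G)
  regroup = solve-∀

prod!-++ : ∀ xs ys → prod! (xs ++ ys) ≡ prod! xs * prod! ys
prod!-++ []       ys = sym (+-identityʳ (prod! ys))
prod!-++ (x ∷ xs) ys = trans (cong (x ! *_) (prod!-++ xs ys)) (sym (*-assoc (x !) _ _))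

prod!-map : ∀ (f g : ℕ → ℕ) n → prod! (map f (applyUpTo g n)) ≡ ∏< n (λ k → f (g k) !)
prod!-map f g zero    = refl
prod!-map f g (suc n) = cong (f (g 0) ! *_) (prod!-map f (λ k → g (suc k)) n)

prod!-concatMap : ∀ (h : ℕ → List ℕ) (g : ℕ → ℕ) n →
                  prod! (concatMap h (applyUpTo g n)) ≡ ∏< n (λ k → prod! (h (g k)))
prod!-concatMap h g zero    = refl
prod!-concatMap h g (suc n) =
  trans (prod!-++ (h (g 0)) _) (cong (prod! (h (g 0)) *_) (prod!-concatMap h (λ k → g (suc k)) n))

αFactors-den : ∀ p → prod! (αFactors p) ≡ den (parts p)
αFactors-den p =
  trans (prod!-++ (concatMap (λ x → proj₁ x ∷ proj₂ x ∷ []) (parts p)) _)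
        (cong (partFactorials (parts p) *_) (trans (prod!-concatMap row (λ k → k) (suc (sum₁ p))) rows))
  where
  row : ℕ → List ℕ
  row k = map (λ l → e p k l) (applyUpTo (λ l → l) (suc (sum₂ p)))
  rows : ∏< (suc (sum₁ p)) (λ k → prod! (row k)) ≡ multFactorials (parts p)
  rows = ∏<-cong (suc (sum₁ p)) (λ k _ → prod!-map (λ l → e p k l) (λ l → l) (suc (sum₂ p)))

fraction : ∀ a b → toℚᵘ (+ a /ℚ suc b) ≃ᵘ mkℚᵘ (+ a) b
fraction a b = toℚᵘ-fromℚᵘ (mkℚᵘ (+ a) b)

fraction-* : ∀ a b c d →
             toℚᵘ ((+ a /ℚ suc b) *ℚ (+ c /ℚ suc d)) ≃ᵘ mkℚᵘ (+ (a * c)) (pred (suc b * suc d))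
fraction-* a b c d =
  ≃-trans (toℚᵘ-homo-* (+ a /ℚ suc b) (+ c /ℚ suc d))
    (≃-trans (*-cong (fraction a b) (fraction c d))
             (≃-reflexive (cong (λ z → mkℚᵘ z _) (sym (ℤ.pos-* a c)))))

fraction-≃ : ∀ u v u′ v′ → u * suc v′ ≡ u′ * suc v → mkℚᵘ (+ u) v ≃ᵘ mkℚᵘ (+ u′) v′
fraction-≃ u v u′ v′ eq = *≡* (trans (sym (ℤ.pos-* u (suc v′))) (trans (cong +_ eq) (ℤ.pos-* u′ (suc v))))

cross-multiply : ∀ a b c d x y .{{_ : NonZero b}} .{{_ : NonZero d}} → a * x * d ≡ y * c * b →
                 (+ a /ℚ b) *ℚ ℕ→ℚ x ≡ ℕ→ℚ y *ℚ (+ c /ℚ d)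
cross-multiply a (suc b) c (suc d) x y eq = toℚᵘ-injective
  (≃-trans (fraction-* a b x 0) (≃-trans (fraction-≃ _ _ _ _ eq′) (≃-sym (fraction-* y 0 c d))))
  where
  eq′ : a * x * (1 * suc d) ≡ y * c * (suc b * 1)
  eq′ rewrite *-identityˡ (suc d) | *-identityʳ (suc b) = eq

ℕ→ℚ-* : ∀ a b → ℕ→ℚ a *ℚ ℕ→ℚ b ≡ ℕ→ℚ (a * b)
ℕ→ℚ-* a b = toℚᵘ-injective (≃-trans (fraction-* a 0 b 0) (≃-sym (fraction (a * b) 0)))

ℕ→ℚ-pred : ∀ k → ℕ→ℚ (suc k) -ℚ 1ℚ ≡ ℕ→ℚ k
ℕ→ℚ-pred k = toℚᵘ-injective
  (≃-trans (toℚᵘ-homo-+ (ℕ→ℚ (suc k)) (-ℚ 1ℚ))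
    (≃-trans (+-cong (fraction (suc k) 0) (≃-refl {toℚᵘ (-ℚ 1ℚ)}))
      (≃-trans (*≡* (cong (λ n → + n *ℤ + 1) (*-identityʳ k))) (≃-sym (fraction k 0)))))

-- α as a ratio num / den, and how α changes between two partitions.

num : TwoDimPartition → ℕ
num p = sum₁ p ! * sum₂ p !

!-step : ∀ {n k} → n ≡ suc k → n ! ≡ n * k !
!-step refl = refl

num-step : ∀ p q {G} → sum₁ p ≡ suc (sum₁ q) → sum₂ p ! ≡ G * sum₂ q ! → num p ≡ sum₁ p * G * num q
num-step p q {G} h₁ h₂ = begin
  sum₁ p ! * sum₂ p !                       ≡⟨ cong₂ _*_ (!-step h₁) h₂ ⟩
  sum₁ p * sum₁ q ! * (G * sum₂ q !)        ≡⟨ regroup (sum₁ p) (sum₁ q !) G (sum₂ q !) ⟩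
  sum₁ p * G * (sum₁ q ! * sum₂ q !)        ∎
  where
  open ≡-Reasoning
  regroup : ∀ n a g b → n * a * (g * b) ≡ n * g * (a * b)
  regroup = solve-∀

α-ratio : ∀ p q X F Z W → num p ≡ F * num q → Z * den (parts p) ≡ W * den (parts q) → X ≡ F * Z →
          α q *ℚ ℕ→ℚ X ≡ ℕ→ℚ W *ℚ α p
α-ratio p q X F Z W hnum hden hX =
  cross-multiply (num q) (prod! (αFactors q)) (num p) (prod! (αFactors p)) X W
                 {{prod!≢0 (αFactors q)}} {{prod!≢0 (αFactors p)}} (begin
    num q * X * prod! (αFactors p)        ≡⟨ cong₂ (λ x d → num q * x * d) hX (αFactors-den p) ⟩
    num q * (F * Z) * den (parts p)       ≡⟨ regroup₁ (num q) F Z (den (parts p)) ⟩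
    F * num q * (Z * den (parts p))       ≡⟨ cong (λ t → F * num q * t) hden ⟩
    F * num q * (W * den (parts q))       ≡⟨ regroup₂ (F * num q) W (den (parts q)) ⟩
    W * (F * num q) * den (parts q)       ≡⟨ cong₂ (λ n d → W * n * d) (sym hnum) (sym (αFactors-den q)) ⟩
    W * num p * prod! (αFactors q)        ∎)
  where
  open ≡-Reasoning
  regroup₁ : ∀ n f z d → n * (f * z) * d ≡ f * n * (z * d)
  regroup₁ = solve-∀
  regroup₂ : ∀ n w d → n * (w * d) ≡ w * n * d
  regroup₂ = solve-∀

removal-mult : ∀ {x y L M} → L ↭ y ∷ M → y ≢ x → mult x L ≡ mult x M
removal-mult {x} {y} {L} {M} σ y≢x = trans (mult-↭ x σ) (cong (_+ mult x M) (δ-diff y x y≢x))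

exchange-mult : ∀ {x y L M} → x ∷ L ↭ y ∷ M → y ≢ x → mult x M ≡ suc (mult x L)
exchange-mult {x} {y} {L} {M} σ y≢x = begin
  mult x M                 ≡⟨ cong (_+ mult x M) (δ-diff y x y≢x) ⟨
  mult x (y ∷ M)           ≡⟨ mult-↭ x σ ⟨
  mult x (x ∷ L)           ≡⟨ cong (_+ mult x L) (δ-same x) ⟩
  suc (mult x L)           ∎
  where open ≡-Reasoning

den-exchange : ∀ {a b c d L M} F → (a , b) ∷ L ↭ (c , d) ∷ M → a ! * b ! ≡ F * (c ! * d !) →
               suc (mult (c , d) M) * den M ≡ F * suc (mult (a , b) L) * den L
den-exchange {a} {b} {c} {d} {L} {M} F σ fact =
  *-cancelˡ-≡ _ _ (c ! * d !) {{m*n≢0 (c !) (d !) {{c !≢0}} {{d !≢0}}}} (begin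
    c ! * d ! * (suc (mult (c , d) M) * den M)    ≡⟨ *-assoc (c ! * d !) _ _ ⟨
    c ! * d ! * suc (mult (c , d) M) * den M      ≡⟨ den-∷ c d M ⟨
    den ((c , d) ∷ M)                             ≡⟨ den-↭ σ ⟨
    den ((a , b) ∷ L)                             ≡⟨ den-∷ a b L ⟩
    a ! * b ! * suc (mult (a , b) L) * den L      ≡⟨ cong (λ t → t * suc (mult (a , b) L) * den L) fact ⟩
    F * (c ! * d !) * suc (mult (a , b) L) * den L ≡⟨ regroup F (c ! * d !) (suc (mult (a , b) L)) (den L) ⟩
    c ! * d ! * (F * suc (mult (a , b) L) * den L) ∎)
  where
  open ≡-Reasoning
  regroup : ∀ f g m D → f * g * m * D ≡ g * (f * m * D)
  regroup = solve-∀

record Step (p q : TwoDimPartition) (d : ℕ) : Set where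
  field
    size-step : size p ≡ d + size q
    sum₁-step : sum₁ p ≡ suc (sum₁ q)
    sum₂-step : sum₂ p ≡ d + sum₂ q

shift-ℤ : ∀ d a → + (d + a) - + d ≡ + a
shift-ℤ d a = begin
  + (d + a) - + d      ≡⟨ ℤ.[+m]-[+n]≡m⊖n (d + a) d ⟩
  (d + a) ⊖ d          ≡⟨ cong ((d + a) ⊖_) (+-identityʳ d) ⟨
  (d + a) ⊖ (d + 0)    ≡⟨ ℤ.+-cancelˡ-⊖ d a 0 ⟩
  + a                  ∎
  where open ≡-Reasoning

ℤ-pred⇔ : ∀ s z → (+ s ≡ + z - + 1) ⇔ (suc s ≡ z)
ℤ-pred⇔ s zero    = mk⇔ (λ ()) (λ ())
ℤ-pred⇔ s (suc z) = mk⇔ (λ eq → cong suc (ℤ.+-injective eq)) (λ eq → cong +_ (suc-injective eq))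

module _ {p q d} (step : Step p q d) where
  open Step step

  step-size : size p ≡ size q + d
  step-size = trans size-step (+-comm d (size q))

  step-sum₁ᶻ : + sum₁ q ≡ + sum₁ p - + 1
  step-sum₁ᶻ = trans (sym (shift-ℤ 1 (sum₁ q))) (cong (λ n → + n - + 1) (sym sum₁-step))

  step-sum₂ᶻ : + sum₂ q ≡ + sum₂ p - + d
  step-sum₂ᶻ = trans (sym (shift-ℤ d (sum₂ q))) (cong (λ n → + n - + d) (sym sum₂-step))

  -- the excess |p| - m is the same for p and q
  excess-invariant : (suc (sum₂ p) ≡ size p) ⇔ (suc (sum₂ q) ≡ size q)
  excess-invariant = mk⇔
    (λ h → +-cancelˡ-≡ d _ _ (trans (+-suc d (sum₂ q)) (trans (cong suc (sym sum₂-step)) (trans h size-step))))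
    (λ h → trans (cong suc sum₂-step) (trans (sym (+-suc d (sum₂ q))) (trans (cong (λ n → d + n) h) (sym size-step))))

  step-⇔ : (p ⊢ᶻ (+ sum₁ p , + size p - + 1)) ⇔ (q ⊢ᶻ (+ sum₁ p - + 1 , + size q - + 1))
  step-⇔ = mk⇔
    (λ (_ , h) → step-sum₁ᶻ , from (ℤ-pred⇔ _ _) (to excess-invariant (to (ℤ-pred⇔ _ _) h)))
    (λ (_ , h) → refl , from (ℤ-pred⇔ _ _) (from excess-invariant (to (ℤ-pred⇔ _ _) h)))
    where open Equivalence

case₁ : ∀ p q → Removes p (1 , 1) q →
    (size p ≡ size q + 1)
  × (q ⊢ᶻ (+ sum₁ p - + 1 , + sum₂ p - + 1))
  × ((p ⊢ᶻ (+ sum₁ p , + size p - + 1)) ⇔ (q ⊢ᶻ (+ sum₁ p - + 1 , + size q - + 1)))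
  × ((0 , 1) ∉ parts q → (0 , 1) ∉ parts p)
  × ((0 , 1) ∉ parts p → (0 , 1) ∉ parts q)
  × (α q *ℚ ℕ→ℚ (sum₁ p * sum₂ p) ≡ ℕ→ℚ (e p 1 1) *ℚ α p)
case₁ p q R =
  step-size step , (step-sum₁ᶻ step , step-sum₂ᶻ step) , step-⇔ step ,
  proj₁ (removal-∉ σ (λ ())) , proj₂ (removal-∉ σ (λ ())) ,
  α-ratio p q (sum₁ p * sum₂ p) (sum₁ p * sum₂ p) 1 (e p 1 1)
    (num-step p q sum₁-step (!-step sum₂-step)) den-ratio (sym (*-identityʳ _))
  where
  σ : parts p ↭ (1 , 1) ∷ parts q
  σ = removes⇒↭ p (1 , 1) q R
  step : Step p q 1
  step = record { size-step = ↭-length σ ; sum₁-step = Σ-↭ proj₁ σ ; sum₂-step = Σ-↭ proj₂ σ }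
  open Step step
  den-ratio : 1 * den (parts p) ≡ e p 1 1 * den (parts q)
  den-ratio = begin
    1 * den (parts p)                                ≡⟨ *-identityˡ _ ⟩
    den (parts p)                                    ≡⟨ den-↭ σ ⟩
    den ((1 , 1) ∷ parts q)                          ≡⟨ den-∷ 1 1 (parts q) ⟩
    1 * suc (e q 1 1) * den (parts q)                ≡⟨ cong (_* den (parts q)) (*-identityˡ (suc (e q 1 1))) ⟩
    suc (e q 1 1) * den (parts q)                    ≡⟨ cong (_* den (parts q)) (mult-↭ (1 , 1) σ) ⟨
    e p 1 1 * den (parts q)                          ∎
    where open ≡-Reasoning

case₂ : ∀ p q i j → IsA i j p q →
    (size p ≡ size q)
  × (q ⊢ᶻ (+ sum₁ p - + 1 , + sum₂ p))
  × ((p ⊢ᶻ (+ sum₁ p , + size p - + 1)) ⇔ (q ⊢ᶻ (+ sum₁ p - + 1 , + size q - + 1)))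
  × ((0 , 1) ∉ parts q → (0 , 1) ∉ parts p)
  × ((i , j) ≢ (1 , 1) → (0 , 1) ∉ parts p → (0 , 1) ∉ parts q)
  × ((i , j) ≡ (1 , 1) → (0 , 1) ∈ parts q)
  × (α q *ℚ ℕ→ℚ (sum₁ p * (e p (i ∸ 1) j + 1)) ≡ ℕ→ℚ (i * e p i j) *ℚ α p)
case₂ p q zero    j (() , _)
case₂ p q (suc i) j (_ , _ , _ , R) =
  size-step , (step-sum₁ᶻ step , cong +_ (sym sum₂-step)) , step-⇔ step ,
  ∉q⇒∉p , (λ ij≢11 → ∉p⇒∉q (λ { refl → ij≢11 refl })) , (λ { refl → 01∈q refl }) ,
  α-ratio p q (sum₁ p * (e p i j + 1)) (sum₁ p * 1) (e p i j + 1) (suc i * e p (suc i) j)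
    (num-step p q sum₁-step (trans (cong _! sum₂-step) (sym (*-identityˡ _))))
    den-ratio (cong (_* (e p i j + 1)) (sym (*-identityʳ (sum₁ p))))
  where
  σ : (suc i , j) ∷ parts q ↭ (i , j) ∷ parts p
  σ = exchange⇒↭ p (suc i , j) (i , j) q R
  step : Step p q 0
  step = record
    { size-step = sym (suc-injective (↭-length σ))
    ; sum₁-step = sym (+-cancelˡ-≡ i _ _ (trans (+-suc i (sum₁ q)) (Σ-↭ proj₁ σ)))
    ; sum₂-step = sym (+-cancelˡ-≡ j _ _ (Σ-↭ proj₂ σ))
    }
  open Step step
  ∉q⇒∉p : (0 , 1) ∉ parts q → (0 , 1) ∉ parts p
  ∉q⇒∉p = proj₁ (exchange-∉ σ (λ ()))
  ∉p⇒∉q : (0 , 1) ≢ (i , j) → (0 , 1) ∉ parts p → (0 , 1) ∉ parts q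
  ∉p⇒∉q = proj₁ (proj₂ (exchange-∉ σ (λ ())))
  01∈q : (0 , 1) ≡ (i , j) → (0 , 1) ∈ parts q
  01∈q = proj₂ (proj₂ (exchange-∉ σ (λ ())))
  den-ratio : (e p i j + 1) * den (parts p) ≡ suc i * e p (suc i) j * den (parts q)
  den-ratio = begin
    (e p i j + 1) * den (parts p)                  ≡⟨ cong (_* den (parts p)) (+-comm (e p i j) 1) ⟩
    suc (e p i j) * den (parts p)                  ≡⟨ den-exchange (suc i) σ (*-assoc (suc i) (i !) (j !)) ⟩
    suc i * suc (e q (suc i) j) * den (parts q)    ≡⟨ cong (λ t → suc i * t * den (parts q)) (exchange-mult σ (λ ())) ⟨
    suc i * e p (suc i) j * den (parts q)          ∎
    where open ≡-Reasoning

case₃ : ∀ p q → Removes₂ p (1 , 0) (0 , 2) q →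
    (size p ≡ size q + 2)
  × (q ⊢ᶻ (+ sum₁ p - + 1 , + sum₂ p - + 2))
  × ((p ⊢ᶻ (+ sum₁ p , + size p - + 1)) ⇔ (q ⊢ᶻ (+ sum₁ p - + 1 , + size q - + 1)))
  × ((0 , 1) ∉ parts q → (0 , 1) ∉ parts p)
  × ((0 , 1) ∉ parts p → (0 , 1) ∉ parts q)
  × (α q *ℚ (ℕ→ℚ (sum₁ p * sum₂ p) *ℚ (ℕ→ℚ (sum₂ p) -ℚ 1ℚ)) ≡ ℕ→ℚ (2 * e p 1 0 * e p 0 2) *ℚ α p)
case₃ p q R =
  step-size step , (step-sum₁ᶻ step , step-sum₂ᶻ step) , step-⇔ step ,
  (λ ∉q → proj₁ (removal-∉ σ (λ ())) (proj₁ (removal-∉ ↭-refl (λ ())) ∉q)) ,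
  (λ ∉p → proj₂ (removal-∉ ↭-refl (λ ())) (proj₂ (removal-∉ σ (λ ())) ∉p)) ,
  trans (cong (α q *ℚ_) factor)
    (α-ratio p q X (sum₁ p * (sum₂ p * suc (sum₂ q))) 1 (2 * e p 1 0 * e p 0 2)
       (num-step p q sum₁-step two-steps) den-ratio (trans (*-assoc (sum₁ p) _ _) (sym (*-identityʳ _))))
  where
  σ : parts p ↭ (1 , 0) ∷ (0 , 2) ∷ parts q
  σ = removes₂⇒↭ p (1 , 0) (0 , 2) q R
  step : Step p q 2
  step = record { size-step = ↭-length σ ; sum₁-step = Σ-↭ proj₁ σ ; sum₂-step = Σ-↭ proj₂ σ }
  open Step step
  X : ℕ
  X = sum₁ p * sum₂ p * suc (sum₂ q)
  factor : ℕ→ℚ (sum₁ p * sum₂ p) *ℚ (ℕ→ℚ (sum₂ p) -ℚ 1ℚ) ≡ ℕ→ℚ X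
  factor = begin
    ℕ→ℚ (sum₁ p * sum₂ p) *ℚ (ℕ→ℚ (sum₂ p) -ℚ 1ℚ)                ≡⟨ cong (λ m → ℕ→ℚ (sum₁ p * sum₂ p) *ℚ (ℕ→ℚ m -ℚ 1ℚ)) sum₂-step ⟩
    ℕ→ℚ (sum₁ p * sum₂ p) *ℚ (ℕ→ℚ (suc (suc (sum₂ q))) -ℚ 1ℚ)    ≡⟨ cong (ℕ→ℚ (sum₁ p * sum₂ p) *ℚ_) (ℕ→ℚ-pred (suc (sum₂ q))) ⟩
    ℕ→ℚ (sum₁ p * sum₂ p) *ℚ ℕ→ℚ (suc (sum₂ q))                  ≡⟨ ℕ→ℚ-* (sum₁ p * sum₂ p) (suc (sum₂ q)) ⟩
    ℕ→ℚ X                                                         ∎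
    where open ≡-Reasoning
  two-steps : sum₂ p ! ≡ sum₂ p * suc (sum₂ q) * sum₂ q !
  two-steps = trans (!-step sum₂-step) (sym (*-assoc (sum₂ p) _ _))
  den-ratio : 1 * den (parts p) ≡ 2 * e p 1 0 * e p 0 2 * den (parts q)
  den-ratio = begin
    1 * den (parts p)                                                   ≡⟨ *-identityˡ _ ⟩
    den (parts p)                                                       ≡⟨ den-↭ σ ⟩
    den ((1 , 0) ∷ (0 , 2) ∷ parts q)                                   ≡⟨ den-∷ 1 0 ((0 , 2) ∷ parts q) ⟩
    1 * suc (e q 1 0) * den ((0 , 2) ∷ parts q)                         ≡⟨ cong (λ t → 1 * suc (e q 1 0) * t) (den-∷ 0 2 (parts q)) ⟩
    1 * suc (e q 1 0) * (2 * suc (e q 0 2) * den (parts q))             ≡⟨ cong₂ (λ a b → 1 * a * (2 * b * den (parts q))) e₁₀ e₀₂ ⟨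
    1 * e p 1 0 * (2 * e p 0 2 * den (parts q))                         ≡⟨ regroup (e p 1 0) (e p 0 2) (den (parts q)) ⟩
    2 * e p 1 0 * e p 0 2 * den (parts q)                               ∎
    where
    open ≡-Reasoning
    e₁₀ : e p 1 0 ≡ suc (e q 1 0)
    e₁₀ = mult-↭ (1 , 0) σ
    e₀₂ : e p 0 2 ≡ suc (e q 0 2)
    e₀₂ = mult-↭ (0 , 2) σ
    regroup : ∀ a b D → 1 * a * (2 * b * D) ≡ 2 * a * b * D
    regroup = solve-∀

case₄ : ∀ p q i j (r : TwoDimPartition) → Removes p (1 , 0) r → IsB i j r q →
    (size p ≡ size q + 1)
  × (q ⊢ᶻ (+ sum₁ p - + 1 , + sum₂ p - + 1))
  × ((p ⊢ᶻ (+ sum₁ p , + size p - + 1)) ⇔ (q ⊢ᶻ (+ sum₁ p - + 1 , + size q - + 1)))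
  × ((0 , 1) ∉ parts q → (0 , 1) ∉ parts p)
  × ((i , j) ≢ (0 , 2) → (0 , 1) ∉ parts p → (0 , 1) ∉ parts q)
  × ((i , j) ≡ (0 , 2) → (0 , 1) ∈ parts q)
  × (α q *ℚ ℕ→ℚ (sum₁ p * sum₂ p * (e r i (j ∸ 1) + 1)) ≡ ℕ→ℚ (j * e p i j * e p 1 0) *ℚ α p)
case₄ p q i zero    r R₁ (() , _)
case₄ p q i (suc j) r R₁ (_ , ij≢01 , _ , R₂) =
  step-size step , (step-sum₁ᶻ step , step-sum₂ᶻ step) , step-⇔ step ,
  (λ ∉q → ∉r⇒∉p (∉q⇒∉r ∉q)) ,
  (λ ij≢02 ∉p → ∉r⇒∉q (λ { refl → ij≢02 refl }) (∉p⇒∉r ∉p)) ,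
  (λ { refl → 01∈q refl }) ,
  α-ratio p q (sum₁ p * sum₂ p * (e r i j + 1)) (sum₁ p * sum₂ p) (e r i j + 1) (suc j * e p i (suc j) * e p 1 0)
    (num-step p q sum₁-step (!-step sum₂-step)) den-ratio refl
  where
  σ₁ : parts p ↭ (1 , 0) ∷ parts r
  σ₁ = removes⇒↭ p (1 , 0) r R₁
  σ₂ : (i , suc j) ∷ parts q ↭ (i , j) ∷ parts r
  σ₂ = exchange⇒↭ r (i , suc j) (i , j) q R₂
  step : Step p q 1
  step = record
    { size-step = trans (↭-length σ₁) (sym (↭-length σ₂))
    ; sum₁-step = trans (Σ-↭ proj₁ σ₁) (cong suc (sym (+-cancelˡ-≡ i _ _ (Σ-↭ proj₁ σ₂))))
    ; sum₂-step = trans (Σ-↭ proj₂ σ₁) (sym (+-cancelˡ-≡ j _ _ (trans (+-suc j (sum₂ q)) (Σ-↭ proj₂ σ₂))))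
    }
  open Step step
  ∉r⇒∉p : (0 , 1) ∉ parts r → (0 , 1) ∉ parts p
  ∉r⇒∉p = proj₁ (removal-∉ σ₁ (λ ()))
  ∉p⇒∉r : (0 , 1) ∉ parts p → (0 , 1) ∉ parts r
  ∉p⇒∉r = proj₂ (removal-∉ σ₁ (λ ()))
  01≢ij : (0 , 1) ≢ (i , suc j)
  01≢ij e = ij≢01 (sym e)
  ∉q⇒∉r : (0 , 1) ∉ parts q → (0 , 1) ∉ parts r
  ∉q⇒∉r = proj₁ (exchange-∉ σ₂ 01≢ij)
  ∉r⇒∉q : (0 , 1) ≢ (i , j) → (0 , 1) ∉ parts r → (0 , 1) ∉ parts q
  ∉r⇒∉q = proj₁ (proj₂ (exchange-∉ σ₂ 01≢ij))
  01∈q : (0 , 1) ≡ (i , j) → (0 , 1) ∈ parts q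
  01∈q = proj₂ (proj₂ (exchange-∉ σ₂ 01≢ij))
  den-ratio : (e r i j + 1) * den (parts p) ≡ suc j * e p i (suc j) * e p 1 0 * den (parts q)
  den-ratio = begin
    (e r i j + 1) * den (parts p)                          ≡⟨ cong₂ _*_ (+-comm (e r i j) 1) (den-↭ σ₁) ⟩
    suc (e r i j) * den ((1 , 0) ∷ parts r)                ≡⟨ cong (suc (e r i j) *_) (den-∷ 1 0 (parts r)) ⟩
    suc (e r i j) * (1 * suc (e r 1 0) * den (parts r))    ≡⟨ cong (λ t → suc (e r i j) * (1 * t * den (parts r))) e₁₀ ⟨
    suc (e r i j) * (1 * e p 1 0 * den (parts r))          ≡⟨ regroup₁ (suc (e r i j)) (e p 1 0) (den (parts r)) ⟩
    e p 1 0 * (suc (e r i j) * den (parts r))              ≡⟨ cong (e p 1 0 *_) (den-exchange (suc j) σ₂ (left-comm (i !) (suc j) (j !))) ⟩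
    e p 1 0 * (suc j * suc (e q i (suc j)) * den (parts q)) ≡⟨ cong (λ t → e p 1 0 * (suc j * t * den (parts q))) e-ij ⟨
    e p 1 0 * (suc j * e p i (suc j) * den (parts q))      ≡⟨ regroup₂ (e p 1 0) (suc j) (e p i (suc j)) (den (parts q)) ⟩
    suc j * e p i (suc j) * e p 1 0 * den (parts q)        ∎
    where
    open ≡-Reasoning
    e₁₀ : e p 1 0 ≡ suc (e r 1 0)
    e₁₀ = mult-↭ (1 , 0) σ₁
    -- (i , j + 1) ≠ (1 , 0) is untouched by the removal and loses one copy in the exchange
    e-ij : e p i (suc j) ≡ suc (e q i (suc j))
    e-ij = trans (removal-mult σ₁ (λ ())) (exchange-mult σ₂ (λ ()))
    regroup₁ : ∀ m a D → m * (1 * a * D) ≡ a * (m * D)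
    regroup₁ = solve-∀
    left-comm : ∀ x y z → x * (y * z) ≡ y * (x * z)
    left-comm = solve-∀
    regroup₂ : ∀ a s b D → a * (s * b * D) ≡ s * b * a * D
    regroup₂ = solve-∀

mainTheorem3 :
  (p q : TwoDimPartition) (n m : ℕ) → p ⊢ (n , m) →
  -- case 1 : q = p \ (1,1)
  (Removes p (1 , 1) q →
      (size p ≡ size q + 1)
    × (q ⊢ᶻ (+ n - + 1 , + m - + 1))
    × ((p ⊢ᶻ (+ n , + size p - + 1)) ⇔ (q ⊢ᶻ (+ n - + 1 , + size q - + 1)))
    × ((0 , 1) ∉ parts q → (0 , 1) ∉ parts p)
    × ((0 , 1) ∉ parts p → (0 , 1) ∉ parts q)
    × (α q *ℚ ℕ→ℚ (n * m) ≡ ℕ→ℚ (e p 1 1) *ℚ α p))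
  -- case 2 : q = A_{i,j}(p)
  × (∀ i j → IsA i j p q →
      (size p ≡ size q)
    × (q ⊢ᶻ (+ n - + 1 , + m))
    × ((p ⊢ᶻ (+ n , + size p - + 1)) ⇔ (q ⊢ᶻ (+ n - + 1 , + size q - + 1)))
    × ((0 , 1) ∉ parts q → (0 , 1) ∉ parts p)
    × ((i , j) ≢ (1 , 1) → (0 , 1) ∉ parts p → (0 , 1) ∉ parts q)
    × ((i , j) ≡ (1 , 1) → (0 , 1) ∈ parts q)
    × (α q *ℚ ℕ→ℚ (n * (e p (i ∸ 1) j + 1)) ≡ ℕ→ℚ (i * e p i j) *ℚ α p))
  -- case 3 : q = p \ (1,0),(0,2)
  × (Removes₂ p (1 , 0) (0 , 2) q →
      (size p ≡ size q + 2)
    × (q ⊢ᶻ (+ n - + 1 , + m - + 2))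
    × ((p ⊢ᶻ (+ n , + size p - + 1)) ⇔ (q ⊢ᶻ (+ n - + 1 , + size q - + 1)))
    × ((0 , 1) ∉ parts q → (0 , 1) ∉ parts p)
    × ((0 , 1) ∉ parts p → (0 , 1) ∉ parts q)
    × (α q *ℚ (ℕ→ℚ (n * m) *ℚ (ℕ→ℚ m -ℚ 1ℚ))
         ≡ ℕ→ℚ (2 * e p 1 0 * e p 0 2) *ℚ α p))
  -- case 4 : q = B_{i,j}(r) with r = p \ (1,0)
  × (∀ i j (r : TwoDimPartition) → Removes p (1 , 0) r → IsB i j r q →
      (size p ≡ size q + 1)
    × (q ⊢ᶻ (+ n - + 1 , + m - + 1))
    × ((p ⊢ᶻ (+ n , + size p - + 1)) ⇔ (q ⊢ᶻ (+ n - + 1 , + size q - + 1)))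
    × ((0 , 1) ∉ parts q → (0 , 1) ∉ parts p)
    × ((i , j) ≢ (0 , 2) → (0 , 1) ∉ parts p → (0 , 1) ∉ parts q)
    × ((i , j) ≡ (0 , 2) → (0 , 1) ∈ parts q)
    × (α q *ℚ ℕ→ℚ (n * m * (e r i (j ∸ 1) + 1))
         ≡ ℕ→ℚ (j * e p i j * e p 1 0) *ℚ α p))
mainTheorem3 p q .(sum₁ p) .(sum₂ p) (refl , refl) = case₁ p q , case₂ p q , case₃ p q , case₄ p q
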